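{- Let $M_1,\dots,M_n$ ($n\ge 2$) be DFAs over a common alphabet $\Sigma$ and let $G$ be the deterministic labeled graph constructed from them as described in the context. A word $u\in(\Sigma\cup\{\lhd,\rhd\})^*$ is synchronizing for $G$ if and only if there exist $v\in(\Sigma\cup\{\rhd\})^*$, an integer $k\ge 1$, and $w\in\bigcap_{i=1}^n L(M_i)$ such that $u=v\lhd w\rhd^k$.
   Context: A DFA $M_i$ has a finite state set $Q_i$ (the $Q_i$ pairwise disjoint), total transition function $\delta_i\colon Q_i\times\Sigma\to Q_i$ (viewed as edges $q\to\delta_i(q,a)$ labeled $a$), initial state $s_i$, accepting set $F_i$; $L(M_i)=\{w\in\Sigma^*:\delta_i(s_i,w)\in F_i\}$. Let $\lhd,\rhd$ be distinct symbols not in $\Sigma$. $G$: add a vertex $t$ with a self loop labeled $\rhd$; for each $i=1,\dots,n$, add vertices $p_i$ and $r_i$, self loops labeled $\rhd$ on $p_i$ and on $r_i$, a self loop labeled $a$ on $p_i$ for each $a\in\Sigma$, embed $M_i$, add an edge labeled $\lhd$ from $p_i$ to $s_i$, for each $q\in F_i$ an edge labeled $\rhd$ from $q$ to $t$, and for each $q\in Q_i\setminus F_i$ an edge labeled $\rhd$ from $q$ to $r_i$. For this deterministic labeled graph (no vertex has two outgoing edges with the same label), $q\cdot u$ denotes the end vertex of the unique path from $q$ labeled $u$ (if it exists), $Q_G\cdot u$ is the set of all such end vertices over all vertices $q$, and $u$ is synchronizing for $G$ if $|Q_G\cdot u|=1$. -}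

module Defs where

open import Data.Nat using (ℕ)
open import Data.Fin using (Fin)
open import Data.Bool using (Bool; true; false; if_then_else_)
open import Data.List using (List; []; _∷_; map; _++_; replicate)
open import Data.Maybe using (Maybe; just; nothing; _>>=_)
open import Data.Product using (∃; ∃-syntax; _×_)
open import Relation.Binary.PropositionalEquality using (_≡_)

record DFA (σ : ℕ) : Set where
  field
    nQ  : ℕ
    δ   : Fin nQ → Fin σ → Fin nQ
    s   : Fin nQ
    acc : Fin nQ → Bool

open DFA public

δ* : ∀ {σ} (M : DFA σ) → Fin (nQ M) → List (Fin σ) → Fin (nQ M)
δ* M q []       = q
δ* M q (a ∷ w)  = δ* M (δ M q a) w

_∈L_ : ∀ {σ} → List (Fin σ) → DFA σ → Set
w ∈L M = acc M (δ* M (s M) w) ≡ true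

data Letter (σ : ℕ) : Set where
  sym : Fin σ → Letter σ
  ◁   : Letter σ
  ▷   : Letter σ

-- vertices of G (the Q_i embedded disjointly via the index i)
data Vertex {σ n : ℕ} (M : Fin n → DFA σ) : Set where
  t  : Vertex M
  p  : Fin n → Vertex M
  r  : Fin n → Vertex M
  st : (i : Fin n) → Fin (nQ (M i)) → Vertex M

step : ∀ {σ n} (M : Fin n → DFA σ) → Vertex M → Letter σ → Maybe (Vertex M)
step M t ▷ = just t
step M t _ = nothing
step M (p i) (sym a) = just (p i)
step M (p i) ▷ = just (p i)
step M (p i) ◁ = just (st i (s (M i)))
step M (r i) ▷ = just (r i)
step M (r i) _ = nothing
step M (st i q) (sym a) = just (st i (δ (M i) q a))
step M (st i q) ▷ = just (if acc (M i) q then t else r i)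
step M (st i q) ◁ = nothing

_·_ : ∀ {σ n} {M : Fin n → DFA σ} → Vertex M → List (Letter σ) → Maybe (Vertex M)
q · [] = just q
_·_ {M = M} q (a ∷ u) = step M q a >>= λ q' → q' · u

-- u is synchronizing for G : |Q_G · u| = 1, i.e. the set of end vertices
-- Q_G · u is a singleton {v₀}
Synchronizing : ∀ {σ n} (M : Fin n → DFA σ) → List (Letter σ) → Set
Synchronizing M u =
  ∃[ v₀ ] ((∃[ q ] (q · u ≡ just v₀)) ×
           (∀ (q v : Vertex M) → q · u ≡ just v → v ≡ v₀))

{-# OPTIONS --safe #-}
module Submission where

-- Every ◁-free word fixes each p i, so a synchronizing word contains ◁.
-- A ◁-edge only leaves some p i, into the start state of M i, and from a
-- state of M i one can read only Σ-letters followed by ▷'s.  Hence the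
-- vertices p i read u = v ◁ w ▷^k to distinct states of the M i when k = 0,
-- and to t or r i (according to whether M i accepts w) when k ≥ 1; these
-- all coincide exactly when every M i accepts w.  Conversely, any vertex
-- that reads such a u passes through some p i and ends at t.

open import Defs
open import Data.Nat using (ℕ; _≤_; zero; suc; s≤s; z≤n)
open import Data.Fin using (Fin; zero; suc)
open import Data.Fin.Properties using (0≢1+n)
open import Data.Empty using (⊥-elim)
open import Data.Bool using (true; false; if_then_else_)
open import Data.Maybe using (just; nothing; _>>=_)
open import Data.Maybe.Properties using (just-injective)
open import Data.List using (List; []; _∷_; map; _++_; replicate; [_])
open import Data.List.Relation.Unary.All using (All; []; _∷_)
open import Data.Product using (∃-syntax; _×_; _,_)
open import Relation.Binary.PropositionalEquality
  using (_≡_; _≢_; refl; trans; cong)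
  renaming (sym to ≡-sym)
open import Function.Bundles using (_⇔_; mk⇔)

data ◁-View {σ : ℕ} : List (Letter σ) → Set where
  ◁-free  : ∀ {u} → All (_≢ ◁) u → ◁-View u
  first-◁ : ∀ {v} rest → All (_≢ ◁) v → ◁-View (v ++ ◁ ∷ rest)

◁-view-∷ : ∀ {σ} {a : Letter σ} {u} → a ≢ ◁ → ◁-View u → ◁-View (a ∷ u)
◁-view-∷ a≢◁ (◁-free nu)       = ◁-free (a≢◁ ∷ nu)
◁-view-∷ a≢◁ (first-◁ rest nv) = first-◁ rest (a≢◁ ∷ nv)

◁-view : ∀ {σ} (u : List (Letter σ)) → ◁-View u
◁-view []          = ◁-free []
◁-view (◁ ∷ u)     = first-◁ {v = []} u []
◁-view (sym a ∷ u) = ◁-view-∷ (λ ()) (◁-view u)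
◁-view (▷ ∷ u)     = ◁-view-∷ (λ ()) (◁-view u)

module _ {σ n : ℕ} (M : Fin n → DFA σ) where

  V : Set
  V = Vertex M

  start : Fin n → V
  start i = st i (s (M i))

  outcome : (i : Fin n) → Fin (nQ (M i)) → V
  outcome i q = if acc (M i) q then t else r i

  outcome-accepting : ∀ i {q} → acc (M i) q ≡ true → outcome i q ≡ t
  outcome-accepting i e = cong (λ b → if b then t else r i) e

  outcome-rejecting : ∀ i {q} → acc (M i) q ≡ false → outcome i q ≡ r i
  outcome-rejecting i e = cong (λ b → if b then t else r i) e

  outcome≡r⇒≡ : ∀ {i j} q → outcome j q ≡ r i → j ≡ i
  outcome≡r⇒≡ {j = j} q e with acc (M j) q
  outcome≡r⇒≡ q refl | false = refl

  ·-++ : ∀ (q : V) u w → q · (u ++ w) ≡ (q · u >>= _· w)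
  ·-++ q []      w = refl
  ·-++ q (a ∷ u) w with step M q a
  ... | just q' = ·-++ q' u w
  ... | nothing = refl

  data Sink : V → Set where
    t-sink : Sink t
    r-sink : ∀ i → Sink (r i)

  outcome-sink : ∀ i q → Sink (outcome i q)
  outcome-sink i q with acc (M i) q
  ... | true  = t-sink
  ... | false = r-sink i

  sink-reads-▷* : ∀ {q} → Sink q → ∀ k → q · replicate k ▷ ≡ just q
  sink-reads-▷* _ zero    = refl
  sink-reads-▷* s (suc k) with s
  ... | t-sink   = sink-reads-▷* s k
  ... | r-sink i = sink-reads-▷* s k

  sink-path⇒▷* : ∀ {q x} → Sink q → ∀ u → q · u ≡ just x → ∃[ k ] u ≡ replicate k ▷
  sink-path⇒▷* s []      _ = zero , refl
  sink-path⇒▷* s (a ∷ u) h with s | a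
  ... | t-sink   | ▷ = let k , e = sink-path⇒▷* s u h in suc k , cong (▷ ∷_) e
  ... | r-sink i | ▷ = let k , e = sink-path⇒▷* s u h in suc k , cong (▷ ∷_) e

  data StateWord : List (Letter σ) → Set where
    letters : ∀ w → StateWord (map sym w)
    stopped : ∀ w k → StateWord (map sym w ++ replicate (suc k) ▷)

  state-path⇒StateWord : ∀ i q rest {x} → st {M = M} i q · rest ≡ just x → StateWord rest
  state-path⇒StateWord i q []            _ = letters []
  state-path⇒StateWord i q (sym a ∷ rest) h with state-path⇒StateWord i (δ (M i) q a) rest h
  ... | letters w   = letters (a ∷ w)
  ... | stopped w k = stopped (a ∷ w) k
  state-path⇒StateWord i q (▷ ∷ rest)    h with sink-path⇒▷* (outcome-sink i q) rest h
  ... | k , refl = stopped [] k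

  state-reads-letters : ∀ i q w → st {M = M} i q · map sym w ≡ just (st i (δ* (M i) q w))
  state-reads-letters i q []      = refl
  state-reads-letters i q (a ∷ w) = state-reads-letters i (δ (M i) q a) w

  state-reads-stopped : ∀ i q w k →
    st {M = M} i q · (map sym w ++ replicate (suc k) ▷) ≡ just (outcome i (δ* (M i) q w))
  state-reads-stopped i q (a ∷ w) k = state-reads-stopped i (δ (M i) q a) w k
  state-reads-stopped i q []      k = sink-reads-▷* (outcome-sink i q) k

  p-reads-◁-free : ∀ i {v} → All (_≢ ◁) v → p {M = M} i · v ≡ just (p i)
  p-reads-◁-free i []                 = refl
  p-reads-◁-free i {sym a ∷ v} (_ ∷ nv) = p-reads-◁-free i nv
  p-reads-◁-free i {▷ ∷ v}     (_ ∷ nv) = p-reads-◁-free i nv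
  p-reads-◁-free i {◁ ∷ v}     (◁≢◁ ∷ _) with () ← ◁≢◁ refl

  p-reads-to-◁ : ∀ i {v} rest → All (_≢ ◁) v → p {M = M} i · (v ++ ◁ ∷ rest) ≡ start i · rest
  p-reads-to-◁ i {v} rest nv rewrite ·-++ (p i) v (◁ ∷ rest) | p-reads-◁-free i nv = refl

  ◁-enters-start : ∀ (q : V) rest {x} → q · (◁ ∷ rest) ≡ just x → ∃[ i ] start i · rest ≡ just x
  ◁-enters-start (p i) rest h = i , h

  path-through-◁ : ∀ (q : V) v rest {x} → q · (v ++ ◁ ∷ rest) ≡ just x →
                   ∃[ i ] start i · rest ≡ just x
  path-through-◁ q v rest h rewrite ·-++ q v (◁ ∷ rest) with q · v
  ... | just q' = ◁-enters-start q' rest h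

SynchronizingShape : ∀ {σ n} → (Fin n → DFA σ) → List (Letter σ) → Set
SynchronizingShape M u =
  ∃[ v ] ∃[ k ] ∃[ w ] (All (_≢ ◁) v × 1 ≤ k × (∀ i → w ∈L M i) ×
                        u ≡ v ++ [ ◁ ] ++ map sym w ++ replicate k ▷)

outcomes-agree⇒accepting : ∀ {σ m} (M : Fin (suc (suc m)) → DFA σ)
  (q : ∀ i → Fin (nQ (M i))) {x} → (∀ i → outcome M i (q i) ≡ x) →
  ∀ i → acc (M i) (q i) ≡ true
outcomes-agree⇒accepting M q agree i with acc (M i) (q i) in rejects
... | true  = refl
... | false = ⊥-elim (0≢1+n (trans (only-i zero) (≡-sym (only-i (suc zero)))))
  where
  only-i : ∀ j → j ≡ i
  only-i j = outcome≡r⇒≡ M (q j) (trans (agree j) (trans (≡-sym (agree i)) (outcome-rejecting M i rejects)))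

theorem4p20 : (σ n : ℕ) → 2 ≤ n → (M : Fin n → DFA σ) → (u : List (Letter σ)) →
    Synchronizing M u ⇔
      (∃[ v ] ∃[ k ] ∃[ w ]
        (All (λ x → x ≢ ◁) v × 1 ≤ k × (∀ i → w ∈L M i) ×
         u ≡ v ++ [ ◁ ] ++ map sym w ++ replicate k ▷))
theorem4p20 σ (suc (suc m)) (s≤s (s≤s z≤n)) M u = mk⇔ synchronizing⇒shape shape⇒synchronizing
  where
  synchronizing⇒shape : Synchronizing M u → SynchronizingShape M u
  synchronizing⇒shape (x , (q , q·u≡x) , unique) with ◁-view u
  ... | ◁-free nu
        with () ← trans (unique _ _ (p-reads-◁-free M zero nu))
                        (≡-sym (unique _ _ (p-reads-◁-free M (suc zero) nu)))
  ... | first-◁ {v} rest nv with path-through-◁ M q v rest q·u≡x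
  ... | i , start·rest≡x with state-path⇒StateWord M i _ rest start·rest≡x
  ... | letters w
        with () ← trans (unique _ _ (trans (p-reads-to-◁ M zero _ nv) (state-reads-letters M zero _ w)))
                        (≡-sym (unique _ _ (trans (p-reads-to-◁ M (suc zero) _ nv)
                                                  (state-reads-letters M (suc zero) _ w))))
  ... | stopped w k = v , suc k , w , nv , s≤s z≤n , accepts , refl
    where
    accepts : ∀ i → w ∈L M i
    accepts = outcomes-agree⇒accepting M _ λ i →
      unique (p i) _ (trans (p-reads-to-◁ M i _ nv) (state-reads-stopped M i _ w k))

  shape⇒synchronizing : SynchronizingShape M u → Synchronizing M u
  shape⇒synchronizing (v , suc k , w , nv , _ , accepts , refl) =
    t , (p zero , trans (p-reads-to-◁ M zero _ nv) (start-reads-t zero)) , reaches-t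
    where
    start-reads-t : ∀ i → start M i · (map sym w ++ replicate (suc k) ▷) ≡ just t
    start-reads-t i = trans (state-reads-stopped M i _ w k) (cong just (outcome-accepting M i (accepts i)))

    reaches-t : ∀ q y → q · (v ++ ◁ ∷ map sym w ++ replicate (suc k) ▷) ≡ just y → y ≡ t
    reaches-t q y h with i , start·rest≡y ← path-through-◁ M q v _ h =
      just-injective (trans (≡-sym start·rest≡y) (start-reads-t i))
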